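{- Let $n\geq1$ and $k$ be integers with $1\leq k\leq \frac{n(n+1)}{2}$, $k\neq 2$ and $k\neq\frac{n(n+1)}{2}-1$. Then $$\frac{1}{n\,m(n,k)}\leq \frac{\mathcal{C}(n,k)}{n!}\leq \frac{2^n}{m(n,k)}.$$
   Context: For a permutation $\sigma=a_1\cdots a_n$ of $\{1,\dots,n\}$, position $j$ is a record position if $a_i<a_j$ for all $i<j$. $\mathcal{C}(n,k)$ denotes the number of permutations of $\{1,\dots,n\}$ whose record positions sum to $k$. For such $n,k$, $m(n,k)$ is the minimum of $\prod_{v\in V}v$ over all subsets $V\subseteq\{1,\dots,n\}$ with $1\in V$ and $\sum_{v\in V}v=k$ (such subsets exist exactly when $k\neq 2$ and $k\neq \frac{n(n+1)}2-1$). -}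

module Defs where

open import Data.Nat using (ℕ; zero; suc; _+_; _*_; _<ᵇ_; _≡ᵇ_; _⊓_; _/_)
open import Data.Bool using (Bool; true; false; _∧_; not; if_then_else_)
open import Data.List using (List; []; _∷_; _++_; map; concatMap; filter; length; foldr)
open import Data.Bool.ListAction using (any; all)
open import Data.Nat.ListAction using (sum; product)
open import Data.Bool.Properties using (T?)
open import Data.Fin using (Fin; toℕ; zero; suc)
open import Data.Vec using (Vec; []; _∷_; toList)

finList : (n : ℕ) → List (Fin n)
finList zero = []
finList (suc n) = zero ∷ map suc (finList n)

allWords : (m n : ℕ) → List (Vec (Fin n) m)
allWords zero n = [] ∷ []
allWords (suc m) n = concatMap (λ x → map (x ∷_) (allWords m n)) (finList n)

distinct : List ℕ → Bool
distinct [] = true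
distinct (x ∷ xs) = not (any (λ y → x ≡ᵇ y) xs) ∧ distinct xs

-- one-line notation a₁⋯aₙ of a permutation of {1,…,n}:
-- the entry at position i is  1 + toℕ (w i)
oneLine : {n : ℕ} → Vec (Fin n) n → List ℕ
oneLine w = map (λ i → suc (toℕ i)) (toList w)

isPerm : {n : ℕ} → Vec (Fin n) n → Bool
isPerm w = distinct (oneLine w)

-- sum of the record positions of a₁⋯aₙ : position j (1-based) is a
-- record position iff a_i < a_j for all i < j.
-- recSumFrom j prefix rest : j = position of the head of rest,
-- prefix = the entries before position j.
recSumFrom : ℕ → List ℕ → List ℕ → ℕ
recSumFrom j pre [] = 0
recSumFrom j pre (a ∷ rest) =
  (if all (λ b → b <ᵇ a) pre then j else 0) + recSumFrom (suc j) (pre ++ (a ∷ [])) rest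

recordPosSum : List ℕ → ℕ
recordPosSum σ = recSumFrom 1 [] σ

𝒞 : ℕ → ℕ → ℕ
𝒞 n k = length (filter (λ w → T? (isPerm w ∧ (recordPosSum (oneLine w) ≡ᵇ k))) (allWords n n))

subsets : ℕ → List (List ℕ)
subsets zero = [] ∷ []
subsets (suc n) = subsets n ++ map (suc n ∷_) (subsets n)

-- minimum of a list (0 for the empty list; never used under the hypotheses)
minList : List ℕ → ℕ
minList [] = 0
minList (x ∷ xs) = foldr _⊓_ x xs

admissible : ℕ → ℕ → List (List ℕ)
admissible n k = filter (λ V → T? (any (λ v → v ≡ᵇ 1) V ∧ (sum V ≡ᵇ k))) (subsets n)

m : ℕ → ℕ → ℕ
m n k = minList (map product (admissible n k))

tri : ℕ → ℕ
tri n = (n * suc n) / 2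

-- Cutting a permutation of {1,…,n+1} after its last entry x and standardising the prefix (via
-- punchIn x) gives an arbitrary permutation of {1,…,n} with the same records, while position n+1
-- is a record exactly when x = n+1.  Hence 𝒞(n+1,·) = n·𝒞(n,·) + 𝒞(n,· − (n+1)), the recurrence of
-- 𝒞(n,k) = Σ_{V ⊆ [n], ΣV = k} ∏_{j ∉ V} (j − 1).  The weight ∏_{j ∉ V} (j − 1) vanishes unless 1 ∈ V,
-- and then lies between n!/(n·∏V) and n!/∏V.  Every weight in the sum is at most n!/m(n,k), which
-- gives the upper bound, and a subset attaining m(n,k) (it exists for the admissible k, by induction
-- on n) contributes a single term large enough for the lower bound.
module Submission where

open import Defs
open import Data.Nat using (ℕ; _+_; _*_; _^_; _≤_; suc; _!)
open import Relation.Binary.PropositionalEquality using (_≢_)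
open import Data.Product using (_×_)

open import Data.Bool using (Bool; true; false; if_then_else_; not; _∧_; _∨_)
open import Data.Bool.ListAction using (any; all)
open import Data.Bool.Properties using (T?; ∨-identityʳ; ∨-zeroʳ; ∨-assoc; ∧-zeroʳ; T-≡; T-∧)
open import Data.Fin using (Fin; zero; suc; punchIn; toℕ)
open import Data.Fin.Properties using (toℕ<n; toℕ-injective; punchInᵢ≢i)
open import Data.List using (List; []; _∷_; _++_; map; concatMap; filter; length)
open import Data.List.Membership.Propositional using (_∈_)
open import Data.List.Membership.Propositional.Properties
  using (∈-map⁺; ∈-map⁻; ∈-filter⁺; ∈-filter⁻; ∈-++⁺ˡ; ∈-++⁺ʳ; foldr-selective)
open import Data.List.Properties
  using (map-++; map-∘; map-cong; foldr-preservesᵒ; filter-all; filter-accept; filter-reject;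
         ++-identityʳ; ++-assoc; length-map; length-++)
open import Data.List.Relation.Unary.All using (All; []; _∷_)
import Data.List.Relation.Unary.All as All
import Data.List.Relation.Unary.All.Properties as All
open import Data.List.Relation.Unary.Any using (Any; here; there)
import Data.List.Relation.Unary.Any as Any
open import Data.List.Relation.Unary.Unique.Propositional using (Unique; []; _∷_)
import Data.List.Relation.Unary.Unique.Propositional.Properties as Unique
open import Data.Nat using (zero; _⊓_; _/_; _<_; _∸_; z≤n; s≤s; s≤s⁻¹; z<s; s<s; _≡ᵇ_; _<ᵇ_; _≟_; _<?_)
open import Data.Nat.DivMod using (m*n/n≡m)
open import Data.Nat.ListAction using (sum; product)
open import Data.Nat.ListAction.Properties using (sum-++)
open import Data.Nat.Properties
open import Algebra.Properties.CommutativeSemigroup +-commutativeSemigroup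
  using () renaming (interchange to +-interchange; x∙yz≈y∙xz to m+[n+o]≡n+[m+o])
open import Algebra.Properties.CommutativeSemigroup *-commutativeSemigroup
  using () renaming (x∙yz≈y∙xz to m*[n*o]≡n*[m*o])
open import Data.Nat.Tactic.RingSolver using (solve-∀)
open import Data.Product using (_,_; ∃; proj₁; proj₂; map₁; map₂)
open import Data.Sum using (_⊎_; inj₁; inj₂)
open import Data.Vec using (Vec; _∷_; _∷ʳ_)
import Data.Vec as Vec
open import Data.Vec.Membership.Propositional using () renaming (_∈_ to _∈ᵥ_)
open import Data.Vec.Membership.Propositional.Properties using (∈-toList⁺)
import Data.Vec.Properties as Vec
open import Data.Vec.Relation.Unary.Any using (here; there)
open import Function using (_∘_; id; Equivalence)
open import Relation.Binary.PropositionalEquality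
open import Relation.Nullary using (contradiction; ¬?; yes; no)

private variable A B : Set

sumMap : (A → ℕ) → List A → ℕ
sumMap f xs = sum (map f xs)

syntax sumMap (λ x → e) xs = ∑[ x ∈ xs ] e

count : (A → Bool) → List A → ℕ
count P xs = ∑[ x ∈ xs ] (if P x then 1 else 0)

length-filter≡count : (P : A → Bool) (xs : List A) → length (filter (λ x → T? (P x)) xs) ≡ count P xs
length-filter≡count P [] = refl
length-filter≡count P (x ∷ xs) with P x
... | true  = cong suc (length-filter≡count P xs)
... | false = length-filter≡count P xs

sumMap-cong : {f g : A → ℕ} → (∀ x → f x ≡ g x) → (xs : List A) → sumMap f xs ≡ sumMap g xs
sumMap-cong f≗g xs = cong sum (map-cong f≗g xs)

count-cong : {P Q : A → Bool} → (∀ x → P x ≡ Q x) → (xs : List A) → count P xs ≡ count Q xs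
count-cong P≗Q = sumMap-cong (λ x → cong (λ b → if b then 1 else 0) (P≗Q x))

sumMap-++ : (f : A → ℕ) (xs ys : List A) → sumMap f (xs ++ ys) ≡ sumMap f xs + sumMap f ys
sumMap-++ f xs ys = trans (cong sum (map-++ f xs ys)) (sum-++ (map f xs) (map f ys))

sumMap-map : (f : B → ℕ) (g : A → B) (xs : List A) → sumMap f (map g xs) ≡ sumMap (f ∘ g) xs
sumMap-map f g xs = cong sum (sym (map-∘ xs))

sumMap-concatMap : (f : B → ℕ) (g : A → List B) (xs : List A) →
                   sumMap f (concatMap g xs) ≡ ∑[ x ∈ xs ] sumMap f (g x)
sumMap-concatMap f g []       = refl
sumMap-concatMap f g (x ∷ xs) =
  trans (sumMap-++ f (g x) (concatMap g xs)) (cong (sumMap f (g x) +_) (sumMap-concatMap f g xs))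

sumMap-zero : {f : A → ℕ} → (∀ x → f x ≡ 0) → (xs : List A) → sumMap f xs ≡ 0
sumMap-zero f≡0 []       = refl
sumMap-zero f≡0 (x ∷ xs) = cong₂ _+_ (f≡0 x) (sumMap-zero f≡0 xs)

sumMap-+ : (f g : A → ℕ) (xs : List A) → ∑[ x ∈ xs ] (f x + g x) ≡ sumMap f xs + sumMap g xs
sumMap-+ f g []       = refl
sumMap-+ f g (x ∷ xs) = trans (cong (f x + g x +_) (sumMap-+ f g xs)) (+-interchange (f x) (g x) _ _)

sumMap-comm : (f : A → B → ℕ) (xs : List A) (ys : List B) →
              ∑[ x ∈ xs ] ∑[ y ∈ ys ] f x y ≡ ∑[ y ∈ ys ] ∑[ x ∈ xs ] f x y
sumMap-comm f []       ys = sym (sumMap-zero (λ _ → refl) ys)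
sumMap-comm f (x ∷ xs) ys =
  trans (cong (sumMap (f x) ys +_) (sumMap-comm f xs ys)) (sym (sumMap-+ (f x) _ ys))

*-distribˡ-sumMap : (k : ℕ) (f : A → ℕ) (xs : List A) → k * sumMap f xs ≡ ∑[ x ∈ xs ] (k * f x)
*-distribˡ-sumMap k f []       = *-zeroʳ k
*-distribˡ-sumMap k f (x ∷ xs) =
  trans (*-distribˡ-+ k (f x) _) (cong (k * f x +_) (*-distribˡ-sumMap k f xs))

∈⇒≤sumMap : (f : A → ℕ) {xs : List A} {x : A} → x ∈ xs → f x ≤ sumMap f xs
∈⇒≤sumMap f {y ∷ ys} (here refl) = m≤m+n (f y) _
∈⇒≤sumMap f {y ∷ ys} (there x∈) = ≤-trans (∈⇒≤sumMap f x∈) (m≤n+m _ (f y))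

sumMap-≤ : (f : A → ℕ) {b : ℕ} (xs : List A) → (∀ {x} → x ∈ xs → f x ≤ b) → sumMap f xs ≤ length xs * b
sumMap-≤ f []       f≤b = z≤n
sumMap-≤ f (x ∷ xs) f≤b = +-mono-≤ (f≤b (here refl)) (sumMap-≤ f xs (f≤b ∘ there))

sumMap-allWords-∷ : ∀ {L n} (f : Vec (Fin n) (suc L) → ℕ) →
                    sumMap f (allWords (suc L) n) ≡ ∑[ x ∈ finList n ] ∑[ w ∈ allWords L n ] f (x ∷ w)
sumMap-allWords-∷ {L} {n} f =
  trans (sumMap-concatMap f (λ x → map (x ∷_) (allWords L n)) (finList n))
        (sumMap-cong (λ x → sumMap-map f (x ∷_) (allWords L n)) (finList n))

sumMap-allWords-∷ʳ : ∀ L n (f : Vec (Fin n) (suc L) → ℕ) →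
                     sumMap f (allWords (suc L) n) ≡ ∑[ x ∈ finList n ] ∑[ w ∈ allWords L n ] f (w ∷ʳ x)
sumMap-allWords-∷ʳ zero    n f = sumMap-allWords-∷ f
sumMap-allWords-∷ʳ (suc L) n f = begin
  sumMap f (allWords (suc (suc L)) n)
    ≡⟨ sumMap-allWords-∷ f ⟩
  ∑[ y ∈ finList n ] sumMap (λ w → f (y ∷ w)) (allWords (suc L) n)
    ≡⟨ sumMap-cong (λ y → sumMap-allWords-∷ʳ L n (λ w → f (y ∷ w))) (finList n) ⟩
  ∑[ y ∈ finList n ] ∑[ x ∈ finList n ] ∑[ w ∈ allWords L n ] f (y ∷ (w ∷ʳ x))
    ≡⟨ sumMap-comm (λ y x → ∑[ w ∈ allWords L n ] f (y ∷ (w ∷ʳ x))) (finList n) (finList n) ⟩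
  ∑[ x ∈ finList n ] ∑[ y ∈ finList n ] ∑[ w ∈ allWords L n ] f (y ∷ (w ∷ʳ x))
    ≡⟨ sumMap-cong (λ x → sym (sumMap-allWords-∷ (λ w → f (w ∷ʳ x)))) (finList n) ⟩
  ∑[ x ∈ finList n ] ∑[ w ∈ allWords (suc L) n ] f (w ∷ʳ x)
    ∎
  where open ≡-Reasoning

sumMap-finList-punchIn : ∀ {n} (v : Fin (suc n)) (g : Fin (suc n) → ℕ) →
                         sumMap g (finList (suc n)) ≡ g v + sumMap (g ∘ punchIn v) (finList n)
sumMap-finList-punchIn {n}     zero    g = cong (g zero +_) (sumMap-map g suc (finList n))
sumMap-finList-punchIn {suc n} (suc v) g = begin
  g zero + sumMap g (map suc (finList (suc n)))
    ≡⟨ cong (g zero +_) (sumMap-map g suc (finList (suc n))) ⟩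
  g zero + sumMap (g ∘ suc) (finList (suc n))
    ≡⟨ cong (g zero +_) (sumMap-finList-punchIn v (g ∘ suc)) ⟩
  g zero + (g (suc v) + rest)
    ≡⟨ m+[n+o]≡n+[m+o] (g zero) (g (suc v)) rest ⟩
  g (suc v) + (g zero + rest)
    ≡⟨ cong (λ s → g (suc v) + (g zero + s)) (sym (sumMap-map (g ∘ punchIn (suc v)) suc (finList n))) ⟩
  g (suc v) + sumMap (g ∘ punchIn (suc v)) (finList (suc n))
    ∎
  where
  open ≡-Reasoning
  rest = sumMap (g ∘ suc ∘ punchIn v) (finList n)

sumMap-allWords-punchIn : ∀ L {n} (v : Fin (suc n)) (f : Vec (Fin (suc n)) L → ℕ) →
                          (∀ {w} → v ∈ᵥ w → f w ≡ 0) →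
                          sumMap f (allWords L (suc n)) ≡ sumMap (f ∘ Vec.map (punchIn v)) (allWords L n)
sumMap-allWords-punchIn zero    v f f≡0 = refl
sumMap-allWords-punchIn (suc L) {n} v f f≡0 = begin
  sumMap f (allWords (suc L) (suc n))
    ≡⟨ sumMap-allWords-∷ f ⟩
  sumMap g (finList (suc n))
    ≡⟨ sumMap-finList-punchIn v g ⟩
  g v + sumMap (g ∘ punchIn v) (finList n)
    ≡⟨ cong (_+ sumMap (g ∘ punchIn v) (finList n)) (sumMap-zero (λ w → f≡0 (here refl)) (allWords L (suc n))) ⟩
  ∑[ y ∈ finList n ] ∑[ w ∈ allWords L (suc n) ] f (punchIn v y ∷ w)
    ≡⟨ sumMap-cong (λ y → sumMap-allWords-punchIn L v (λ w → f (punchIn v y ∷ w)) (f≡0 ∘ there)) (finList n) ⟩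
  ∑[ y ∈ finList n ] ∑[ w ∈ allWords L n ] f (punchIn v y ∷ Vec.map (punchIn v) w)
    ≡⟨ sym (sumMap-allWords-∷ (f ∘ Vec.map (punchIn v))) ⟩
  sumMap (f ∘ Vec.map (punchIn v)) (allWords (suc L) n)
    ∎
  where
  open ≡-Reasoning
  g : Fin (suc n) → ℕ
  g x = ∑[ w ∈ allWords L (suc n) ] f (x ∷ w)

≡ᵇ-refl : ∀ n → (n ≡ᵇ n) ≡ true
≡ᵇ-refl zero    = refl
≡ᵇ-refl (suc n) = ≡ᵇ-refl n

≡⇒≡ᵇ≡true : ∀ {m n} → m ≡ n → (m ≡ᵇ n) ≡ true
≡⇒≡ᵇ≡true {m} refl = ≡ᵇ-refl m

≢⇒≡ᵇ≡false : ∀ {m n} → m ≢ n → (m ≡ᵇ n) ≡ false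
≢⇒≡ᵇ≡false {zero}  {zero}  m≢n = contradiction refl m≢n
≢⇒≡ᵇ≡false {zero}  {suc n} _   = refl
≢⇒≡ᵇ≡false {suc m} {zero}  _   = refl
≢⇒≡ᵇ≡false {suc m} {suc n} m≢n = ≢⇒≡ᵇ≡false (m≢n ∘ cong suc)

≡ᵇ-via-<ᵇ : ∀ m n → (m ≡ᵇ n) ≡ not ((m <ᵇ n) ∨ (n <ᵇ m))
≡ᵇ-via-<ᵇ zero    zero    = refl
≡ᵇ-via-<ᵇ zero    (suc n) = refl
≡ᵇ-via-<ᵇ (suc m) zero    = refl
≡ᵇ-via-<ᵇ (suc m) (suc n) = ≡ᵇ-via-<ᵇ m n

any-∷ʳ : (p : A → Bool) (ys : List A) (a : A) → any p (ys ++ a ∷ []) ≡ any p ys ∨ p a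
any-∷ʳ p []       a = ∨-identityʳ (p a)
any-∷ʳ p (y ∷ ys) a = trans (cong (p y ∨_) (any-∷ʳ p ys a)) (sym (∨-assoc (p y) _ _))

distinct-∷ʳ-∉ : ∀ {a ys} → All (_≢ a) ys → distinct (ys ++ a ∷ []) ≡ distinct ys
distinct-∷ʳ-∉                 []            = refl
distinct-∷ʳ-∉ {a} {y ∷ ys} (y≢a ∷ ys≢a) = cong₂ (λ b d → not b ∧ d) y∉ys∷ʳa (distinct-∷ʳ-∉ ys≢a)
  where
  y∉ys∷ʳa : any (y ≡ᵇ_) (ys ++ a ∷ []) ≡ any (y ≡ᵇ_) ys
  y∉ys∷ʳa = trans (any-∷ʳ (y ≡ᵇ_) ys a) (trans (cong (any (y ≡ᵇ_) ys ∨_) (≢⇒≡ᵇ≡false y≢a)) (∨-identityʳ _))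

distinct-∷ʳ-∈ : ∀ {a ys} → a ∈ ys → distinct (ys ++ a ∷ []) ≡ false
distinct-∷ʳ-∈ {a} {a ∷ ys} (here refl) = cong (λ b → not b ∧ distinct (ys ++ a ∷ [])) a∈ys∷ʳa
  where
  a∈ys∷ʳa : any (a ≡ᵇ_) (ys ++ a ∷ []) ≡ true
  a∈ys∷ʳa = trans (any-∷ʳ (a ≡ᵇ_) ys a) (trans (cong (any (a ≡ᵇ_) ys ∨_) (≡ᵇ-refl a)) (∨-zeroʳ _))
distinct-∷ʳ-∈ {a} {y ∷ ys} (there a∈ys) =
  trans (cong (not (any (y ≡ᵇ_) (ys ++ a ∷ [])) ∧_) (distinct-∷ʳ-∈ a∈ys)) (∧-zeroʳ _)

distinct⇒Unique : ∀ {ys} → distinct ys ≡ true → Unique ys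
distinct⇒Unique {[]}     _ = []
distinct⇒Unique {y ∷ ys} d with any (y ≡ᵇ_) ys in y∉ys
... | true  = contradiction d λ ()
... | false = ≢-from-any ys y∉ys ∷ distinct⇒Unique d
  where
  ≢-from-any : ∀ zs → any (y ≡ᵇ_) zs ≡ false → All (y ≢_) zs
  ≢-from-any []       _ = []
  ≢-from-any (z ∷ zs) h with y ≡ᵇ z in y≡ᵇz
  ... | false = (λ { refl → contradiction (trans (sym y≡ᵇz) (≡ᵇ-refl y)) λ () }) ∷ ≢-from-any zs h

length≤1+length-filter≢ : ∀ c {ys : List ℕ} → Unique ys → length ys ≤ suc (length (filter (λ y → ¬? (y ≟ c)) ys))
length≤1+length-filter≢ c {[]}     _          = z≤n
length≤1+length-filter≢ c {y ∷ ys} (y∉ys ∷ u) with y ≟ c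
... | yes refl = ≤-reflexive (cong (suc ∘ length) (begin
  ys                 ≡⟨ filter-all ≢c? (All.map ≢-sym y∉ys) ⟨
  filter ≢c? ys      ≡⟨ filter-reject ≢c? (λ c≢c → c≢c refl) ⟨
  filter ≢c? (c ∷ ys) ∎))
  where
  open ≡-Reasoning
  ≢c? = λ y → ¬? (y ≟ c)
... | no  y≢c  = ≤-trans (s≤s (length≤1+length-filter≢ c u))
                         (≤-reflexive (cong (suc ∘ length) (sym (filter-accept (λ y → ¬? (y ≟ c)) y≢c))))

pigeonhole : ∀ b {ys : List ℕ} → Unique ys → All (_< b) ys → length ys ≤ b
pigeonhole zero    {[]}    _ _          = z≤n
pigeonhole zero    {_ ∷ _} _ (() ∷ _)
pigeonhole (suc c) {ys}    u ys<1+c     =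
  ≤-trans (length≤1+length-filter≢ c u) (s≤s (pigeonhole c (Unique.filter⁺ ≢c? u) filtered<c))
  where
  ≢c? = λ y → ¬? (y ≟ c)
  filtered<c : All (_< c) (filter ≢c? ys)
  filtered<c = All.zipWith (λ (y<1+c , y≢c) → ≤∧≢⇒< (s≤s⁻¹ y<1+c) y≢c)
                           (All.filter⁺ ≢c? ys<1+c , All.all-filter ≢c? ys)

SameOrder : (A → ℕ) → (A → ℕ) → Set
SameOrder g h = ∀ a b → (g a <ᵇ g b) ≡ (h a <ᵇ h b)

distinct-relabel : {g h : A → ℕ} → SameOrder g h → ∀ ℓ → distinct (map g ℓ) ≡ distinct (map h ℓ)
distinct-relabel         g~h []      = refl
distinct-relabel {g = g} {h} g~h (a ∷ ℓ) = cong₂ (λ b d → not b ∧ d) (any-relabel ℓ) (distinct-relabel g~h ℓ)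
  where
  same-≡ᵇ : ∀ b → (g a ≡ᵇ g b) ≡ (h a ≡ᵇ h b)
  same-≡ᵇ b = begin
    g a ≡ᵇ g b                          ≡⟨ ≡ᵇ-via-<ᵇ (g a) (g b) ⟩
    not ((g a <ᵇ g b) ∨ (g b <ᵇ g a))   ≡⟨ cong₂ (λ u v → not (u ∨ v)) (g~h a b) (g~h b a) ⟩
    not ((h a <ᵇ h b) ∨ (h b <ᵇ h a))   ≡⟨ ≡ᵇ-via-<ᵇ (h a) (h b) ⟨
    h a ≡ᵇ h b                          ∎
    where open ≡-Reasoning
  any-relabel : ∀ ℓ → any (g a ≡ᵇ_) (map g ℓ) ≡ any (h a ≡ᵇ_) (map h ℓ)
  any-relabel []      = refl
  any-relabel (b ∷ ℓ) = cong₂ _∨_ (same-≡ᵇ b) (any-relabel ℓ)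

recSumFrom-relabel : {g h : A → ℕ} → SameOrder g h →
                     ∀ j pre ys → recSumFrom j (map g pre) (map g ys) ≡ recSumFrom j (map h pre) (map h ys)
recSumFrom-relabel                 g~h j pre []       = refl
recSumFrom-relabel {g = g} {h} g~h j pre (y ∷ ys) =
  cong₂ _+_ (cong (λ b → if b then j else 0) (all-relabel pre)) (begin
    recSumFrom (suc j) (map g pre ++ g y ∷ []) (map g ys)
      ≡⟨ cong (λ p → recSumFrom (suc j) p (map g ys)) (map-++ g pre (y ∷ [])) ⟨
    recSumFrom (suc j) (map g (pre ++ y ∷ [])) (map g ys)
      ≡⟨ recSumFrom-relabel g~h (suc j) (pre ++ y ∷ []) ys ⟩
    recSumFrom (suc j) (map h (pre ++ y ∷ [])) (map h ys)
      ≡⟨ cong (λ p → recSumFrom (suc j) p (map h ys)) (map-++ h pre (y ∷ [])) ⟩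
    recSumFrom (suc j) (map h pre ++ h y ∷ []) (map h ys)
      ∎)
  where
  open ≡-Reasoning
  all-relabel : ∀ pre → all (_<ᵇ g y) (map g pre) ≡ all (_<ᵇ h y) (map h pre)
  all-relabel []        = refl
  all-relabel (b ∷ pre) = cong₂ _∧_ (g~h b y) (all-relabel pre)

recSumFrom-∷ʳ : ∀ j pre ys a → recSumFrom j pre (ys ++ a ∷ []) ≡
                recSumFrom j pre ys + (if all (_<ᵇ a) (pre ++ ys) then j + length ys else 0)
recSumFrom-∷ʳ j pre []       a rewrite ++-identityʳ pre | +-identityʳ j = +-identityʳ _
recSumFrom-∷ʳ j pre (y ∷ ys) a
  rewrite recSumFrom-∷ʳ (suc j) (pre ++ y ∷ []) ys a | ++-assoc pre (y ∷ []) ys | +-suc j (length ys)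
  = sym (+-assoc (if all (_<ᵇ y) pre then j else 0) _ _)

entries : ∀ {n L} → Vec (Fin n) L → List ℕ
entries w = map (λ i → suc (toℕ i)) (Vec.toList w)

entries-∷ʳ : ∀ {n L} (w : Vec (Fin n) L) (x : Fin n) → entries (w ∷ʳ x) ≡ entries w ++ suc (toℕ x) ∷ []
entries-∷ʳ w x = trans (cong (map _) (Vec.toList-∷ʳ x w)) (map-++ _ (Vec.toList w) (x ∷ []))

entries-map : ∀ {m n L} (f : Fin m → Fin n) (w : Vec (Fin m) L) →
              entries (Vec.map f w) ≡ map (λ i → suc (toℕ (f i))) (Vec.toList w)
entries-map f w = trans (cong (map _) (Vec.toList-map f w)) (sym (map-∘ (Vec.toList w)))

punchIn-sameOrder : ∀ {n} (x : Fin (suc n)) → SameOrder (λ i → suc (toℕ (punchIn x i))) (λ i → suc (toℕ i))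
punchIn-sameOrder zero    i       j       = refl
punchIn-sameOrder (suc x) zero    zero    = refl
punchIn-sameOrder (suc x) zero    (suc j) = refl
punchIn-sameOrder (suc x) (suc i) zero    = refl
punchIn-sameOrder (suc x) (suc i) (suc j) = punchIn-sameOrder x i j

punchIn-last : ∀ {n} (x : Fin (suc n)) → toℕ x ≡ n → ∀ i → (toℕ (punchIn x i) <ᵇ toℕ x) ≡ true
punchIn-last {suc n} (suc x) x≡n zero    = refl
punchIn-last {suc n} (suc x) x≡n (suc i) = punchIn-last x (suc-injective x≡n) i

punchIn<ᵇ⇒< : ∀ {n} (x : Fin (suc n)) i → (toℕ (punchIn x i) <ᵇ toℕ x) ≡ true → toℕ i < toℕ x
punchIn<ᵇ⇒< (suc x) zero    _  = z<s
punchIn<ᵇ⇒< (suc x) (suc i) lt = s<s (punchIn<ᵇ⇒< x i lt)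

all-map≡true : {p : ℕ → Bool} {f : A → ℕ} → (∀ a → p (f a) ≡ true) → ∀ ℓ → all p (map f ℓ) ≡ true
all-map≡true h []      = refl
all-map≡true h (a ∷ ℓ) = cong₂ _∧_ (h a) (all-map≡true h ℓ)

all-map≡true⁻ : {p : ℕ → Bool} {f : A → ℕ} → ∀ ℓ → all p (map f ℓ) ≡ true → All (λ a → p (f a) ≡ true) ℓ
all-map≡true⁻ []      _ = []
all-map≡true⁻ {p = p} {f} (a ∷ ℓ) h with p (f a) in pfa
... | true = pfa ∷ all-map≡true⁻ ℓ h

-- If x is not the maximum, the n distinct entries of w cannot all lie below x (pigeonhole).
last-isRecord : ∀ {n} (x : Fin (suc n)) (w : Vec (Fin n) n) → isPerm w ≡ true →
                all (_<ᵇ suc (toℕ x)) (entries (Vec.map (punchIn x) w)) ≡ (toℕ x ≡ᵇ n)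
last-isRecord {n} x w perm rewrite entries-map (punchIn x) w with toℕ x ≟ n
... | yes x≡n = trans (all-map≡true (punchIn-last x x≡n) (Vec.toList w)) (sym (≡⇒≡ᵇ≡true x≡n))
... | no  x≢n with all (_<ᵇ suc (toℕ x)) (map (λ i → suc (toℕ (punchIn x i))) (Vec.toList w)) in allBelow
...   | false = sym (≢⇒≡ᵇ≡false x≢n)
...   | true  = contradiction (pigeonhole (toℕ x) unique below) (<⇒≱ (subst (toℕ x <_) (sym length≡n) x<n))
  where
  ℓ = Vec.toList w
  unique : Unique (map toℕ ℓ)
  unique = Unique.map⁻ (subst Unique (map-∘ {g = suc} ℓ) (distinct⇒Unique perm))
  below : All (_< toℕ x) (map toℕ ℓ)
  below = All.map⁺ (All.map (λ {i} → punchIn<ᵇ⇒< x i) (all-map≡true⁻ ℓ allBelow))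
  length≡n : length (map toℕ ℓ) ≡ n
  length≡n = trans (length-map toℕ ℓ) (Vec.length-toList w)
  x<n : toℕ x < n
  x<n = ≤∧≢⇒< (s≤s⁻¹ (toℕ<n x)) x≢n

isPerm-∷ʳ-∈ : ∀ {n} {x : Fin (suc n)} {w : Vec (Fin (suc n)) n} → x ∈ᵥ w → isPerm (w ∷ʳ x) ≡ false
isPerm-∷ʳ-∈ {x = x} {w} x∈w = trans (cong distinct (entries-∷ʳ w x)) (distinct-∷ʳ-∈ (∈-map⁺ _ (∈-toList⁺ x∈w)))

isPerm-punchIn-∷ʳ : ∀ {n} (x : Fin (suc n)) (w : Vec (Fin n) n) → isPerm (Vec.map (punchIn x) w ∷ʳ x) ≡ isPerm w
isPerm-punchIn-∷ʳ x w = begin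
  distinct (entries (Vec.map (punchIn x) w ∷ʳ x))
    ≡⟨ cong distinct (entries-∷ʳ (Vec.map (punchIn x) w) x) ⟩
  distinct (entries (Vec.map (punchIn x) w) ++ suc (toℕ x) ∷ [])
    ≡⟨ cong (λ ys → distinct (ys ++ _)) (entries-map (punchIn x) w) ⟩
  distinct (map (λ i → suc (toℕ (punchIn x i))) ℓ ++ suc (toℕ x) ∷ [])
    ≡⟨ distinct-∷ʳ-∉ (All.map⁺ (All.universal (λ i → punchInᵢ≢i x i ∘ toℕ-injective ∘ suc-injective) ℓ)) ⟩
  distinct (map (λ i → suc (toℕ (punchIn x i))) ℓ)
    ≡⟨ distinct-relabel (punchIn-sameOrder x) ℓ ⟩
  distinct (entries w)
    ∎
  where
  open ≡-Reasoning
  ℓ = Vec.toList w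

recordPosSum-punchIn-∷ʳ : ∀ {n} (x : Fin (suc n)) (w : Vec (Fin n) n) → isPerm w ≡ true →
                          recordPosSum (oneLine (Vec.map (punchIn x) w ∷ʳ x))
                            ≡ recordPosSum (oneLine w) + (if toℕ x ≡ᵇ n then suc n else 0)
recordPosSum-punchIn-∷ʳ {n} x w perm = begin
  recSumFrom 1 [] (entries (Vec.map (punchIn x) w ∷ʳ x))
    ≡⟨ cong (recSumFrom 1 []) (entries-∷ʳ (Vec.map (punchIn x) w) x) ⟩
  recSumFrom 1 [] (ys ++ suc (toℕ x) ∷ [])
    ≡⟨ recSumFrom-∷ʳ 1 [] ys (suc (toℕ x)) ⟩
  recSumFrom 1 [] ys + (if all (_<ᵇ suc (toℕ x)) ys then suc (length ys) else 0)
    ≡⟨ cong₂ (λ r b → r + (if b then suc (length ys) else 0)) relabel (last-isRecord x w perm) ⟩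
  recSumFrom 1 [] (entries w) + (if toℕ x ≡ᵇ n then suc (length ys) else 0)
    ≡⟨ cong (λ l → recSumFrom 1 [] (entries w) + (if toℕ x ≡ᵇ n then suc l else 0)) length-ys ⟩
  recSumFrom 1 [] (entries w) + (if toℕ x ≡ᵇ n then suc n else 0)
    ∎
  where
  open ≡-Reasoning
  ys = entries (Vec.map (punchIn x) w)
  relabel : recSumFrom 1 [] ys ≡ recSumFrom 1 [] (entries w)
  relabel = trans (cong (recSumFrom 1 []) (entries-map (punchIn x) w))
                  (recSumFrom-relabel (punchIn-sameOrder x) 1 [] (Vec.toList w))
  length-ys : length ys ≡ n
  length-ys = trans (length-map _ (Vec.toList (Vec.map (punchIn x) w))) (Vec.length-toList (Vec.map (punchIn x) w))

sumMap-finList-isLast : ∀ n (G : Bool → ℕ) → ∑[ x ∈ finList (suc n) ] G (toℕ x ≡ᵇ n) ≡ n * G false + G true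
sumMap-finList-isLast zero    G = +-identityʳ (G true)
sumMap-finList-isLast (suc n) G = begin
  G false + sumMap (λ x → G (toℕ x ≡ᵇ suc n)) (map suc (finList (suc n)))
    ≡⟨ cong (G false +_) (sumMap-map (λ x → G (toℕ x ≡ᵇ suc n)) suc (finList (suc n))) ⟩
  G false + ∑[ x ∈ finList (suc n) ] G (toℕ x ≡ᵇ n)
    ≡⟨ cong (G false +_) (sumMap-finList-isLast n G) ⟩
  G false + (n * G false + G true)
    ≡⟨ +-assoc (G false) _ _ ⟨
  suc n * G false + G true
    ∎
  where open ≡-Reasoning

permCount : ℕ → (ℕ → Bool) → ℕ
permCount n c = count (λ w → isPerm w ∧ c (recordPosSum (oneLine w))) (allWords n n)

permCount-suc : ∀ n c → permCount (suc n) c ≡ n * permCount n c + permCount n (λ s → c (suc n + s))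
permCount-suc n c = begin
  count P (allWords (suc n) (suc n))
    ≡⟨ sumMap-allWords-∷ʳ n (suc n) (indicator ∘ P) ⟩
  ∑[ x ∈ finList (suc n) ] ∑[ w ∈ allWords n (suc n) ] indicator (P (w ∷ʳ x))
    ≡⟨ sumMap-cong (λ x → sumMap-allWords-punchIn n x (λ w → indicator (P (w ∷ʳ x))) (vanishes x)) (finList (suc n)) ⟩
  ∑[ x ∈ finList (suc n) ] ∑[ w ∈ allWords n n ] indicator (P (Vec.map (punchIn x) w ∷ʳ x))
    ≡⟨ sumMap-cong (λ x → sumMap-cong (λ w → cong indicator (P-punchIn-∷ʳ x w)) (allWords n n)) (finList (suc n)) ⟩
  ∑[ x ∈ finList (suc n) ] G (toℕ x ≡ᵇ n)
    ≡⟨ sumMap-finList-isLast n G ⟩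
  n * G false + G true
    ≡⟨ cong₂ (λ a b → n * a + b) (count-cong (λ w → cong (λ r → isPerm w ∧ c r) (+-identityʳ _)) (allWords n n))
                                 (count-cong (λ w → cong (λ r → isPerm w ∧ c r) (+-comm _ (suc n))) (allWords n n)) ⟩
  n * permCount n c + permCount n (λ s → c (suc n + s))
    ∎
  where
  open ≡-Reasoning
  indicator : Bool → ℕ
  indicator b = if b then 1 else 0
  P : ∀ {m} → Vec (Fin m) m → Bool
  P w = isPerm w ∧ c (recordPosSum (oneLine w))
  G : Bool → ℕ
  G b = count (λ w → isPerm w ∧ c (recordPosSum (oneLine w) + (if b then suc n else 0))) (allWords n n)
  vanishes : ∀ x {w} → x ∈ᵥ w → indicator (P (w ∷ʳ x)) ≡ 0
  vanishes x {w} x∈w = cong (λ b → indicator (b ∧ c (recordPosSum (oneLine (w ∷ʳ x))))) (isPerm-∷ʳ-∈ x∈w)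
  P-punchIn-∷ʳ : ∀ x w → P (Vec.map (punchIn x) w ∷ʳ x)
                 ≡ (isPerm w ∧ c (recordPosSum (oneLine w) + (if toℕ x ≡ᵇ n then suc n else 0)))
  P-punchIn-∷ʳ x w with isPerm w in perm
  ... | false = cong (_∧ c (recordPosSum (oneLine (Vec.map (punchIn x) w ∷ʳ x)))) (trans (isPerm-punchIn-∷ʳ x w) perm)
  ... | true  = cong₂ (λ b r → b ∧ c r) (trans (isPerm-punchIn-∷ʳ x w) perm) (recordPosSum-punchIn-∷ʳ x w perm)

-- each V ⊆ {1,…,n}, listed in the order of `subsets n`, with weight ∏_{j ≤ n, j ∉ V} (j − 1)
weightedSubsets : ℕ → List (List ℕ × ℕ)
weightedSubsets zero    = ([] , 1) ∷ []
weightedSubsets (suc n) = map (map₂ (n *_)) (weightedSubsets n) ++ map (map₁ (suc n ∷_)) (weightedSubsets n)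

weightedCount : ℕ → (ℕ → Bool) → ℕ
weightedCount n c = ∑[ p ∈ weightedSubsets n ] (if c (sum (proj₁ p)) then proj₂ p else 0)

weightedCount-suc : ∀ n c → weightedCount (suc n) c ≡ n * weightedCount n c + weightedCount n (λ s → c (suc n + s))
weightedCount-suc n c = begin
  sumMap term (map (map₂ (n *_)) ws ++ map (map₁ (suc n ∷_)) ws)
    ≡⟨ sumMap-++ term (map (map₂ (n *_)) ws) _ ⟩
  sumMap term (map (map₂ (n *_)) ws) + sumMap term (map (map₁ (suc n ∷_)) ws)
    ≡⟨ cong₂ _+_ (sumMap-map term (map₂ (n *_)) ws) (sumMap-map term (map₁ (suc n ∷_)) ws) ⟩
  sumMap (term ∘ map₂ (n *_)) ws + weightedCount n (λ s → c (suc n + s))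
    ≡⟨ cong (_+ shifted) (sumMap-cong (λ p → if-scale (c (sum (proj₁ p)))) ws) ⟩
  ∑[ p ∈ ws ] (n * term p) + weightedCount n (λ s → c (suc n + s))
    ≡⟨ cong (_+ shifted) (*-distribˡ-sumMap n term ws) ⟨
  n * weightedCount n c + weightedCount n (λ s → c (suc n + s))
    ∎
  where
  open ≡-Reasoning
  ws = weightedSubsets n
  shifted = weightedCount n (λ s → c (suc n + s))
  term : List ℕ × ℕ → ℕ
  term p = if c (sum (proj₁ p)) then proj₂ p else 0
  if-scale : ∀ {w} b → (if b then n * w else 0) ≡ n * (if b then w else 0)
  if-scale true  = refl
  if-scale false = sym (*-zeroʳ n)

permCount≡weightedCount : ∀ n c → permCount n c ≡ weightedCount n c
permCount≡weightedCount zero    c = refl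
permCount≡weightedCount (suc n) c = begin
  permCount (suc n) c
    ≡⟨ permCount-suc n c ⟩
  n * permCount n c + permCount n (λ s → c (suc n + s))
    ≡⟨ cong₂ (λ a b → n * a + b) (permCount≡weightedCount n c) (permCount≡weightedCount n (λ s → c (suc n + s))) ⟩
  n * weightedCount n c + weightedCount n (λ s → c (suc n + s))
    ≡⟨ weightedCount-suc n c ⟨
  weightedCount (suc n) c
    ∎
  where open ≡-Reasoning

𝒞≡weightedCount : ∀ n k → 𝒞 n k ≡ weightedCount n (_≡ᵇ k)
𝒞≡weightedCount n k = trans (length-filter≡count _ (allWords n n)) (permCount≡weightedCount n (_≡ᵇ k))

All-weightedSubsets-suc : ∀ {P Q : List ℕ × ℕ → Set} n →
                          (∀ V w → P (V , w) → Q (V , n * w)) → (∀ V w → P (V , w) → Q (suc n ∷ V , w)) →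
                          All P (weightedSubsets n) → All Q (weightedSubsets (suc n))
All-weightedSubsets-suc n skip take ps = All.++⁺ (All.map⁺ (All.map (skip _ _) ps)) (All.map⁺ (All.map (take _ _) ps))

map-proj₁-weightedSubsets : ∀ n → map proj₁ (weightedSubsets n) ≡ subsets n
map-proj₁-weightedSubsets zero    = refl
map-proj₁-weightedSubsets (suc n) = begin
  map proj₁ (map (map₂ (n *_)) ws ++ map (map₁ (suc n ∷_)) ws)
    ≡⟨ map-++ proj₁ (map (map₂ (n *_)) ws) _ ⟩
  map proj₁ (map (map₂ (n *_)) ws) ++ map proj₁ (map (map₁ (suc n ∷_)) ws)
    ≡⟨ cong₂ _++_ (map-∘ ws) (map-∘ ws) ⟨
  map proj₁ ws ++ map ((suc n ∷_) ∘ proj₁) ws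
    ≡⟨ cong (map proj₁ ws ++_) (map-∘ ws) ⟩
  map proj₁ ws ++ map (suc n ∷_) (map proj₁ ws)
    ≡⟨ cong (λ Vs → Vs ++ map (suc n ∷_) Vs) (map-proj₁-weightedSubsets n) ⟩
  subsets n ++ map (suc n ∷_) (subsets n)
    ∎
  where
  open ≡-Reasoning
  ws = weightedSubsets n

length-weightedSubsets : ∀ n → length (weightedSubsets n) ≡ 2 ^ n
length-weightedSubsets zero    = refl
length-weightedSubsets (suc n) = begin
  length (map (map₂ (n *_)) ws ++ map (map₁ (suc n ∷_)) ws)   ≡⟨ length-++ (map (map₂ (n *_)) ws) ⟩
  length (map (map₂ (n *_)) ws) + length (map (map₁ (suc n ∷_)) ws)
    ≡⟨ cong₂ _+_ (length-map _ ws) (length-map _ ws) ⟩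
  length ws + length ws                                       ≡⟨ cong (λ l → l + l) (length-weightedSubsets n) ⟩
  2 ^ n + 2 ^ n                                               ≡⟨ cong (2 ^ n +_) (+-identityʳ (2 ^ n)) ⟨
  2 ^ suc n                                                   ∎
  where
  open ≡-Reasoning
  ws = weightedSubsets n

weight*product≤! : ∀ n → All (λ p → proj₂ p * product (proj₁ p) ≤ n !) (weightedSubsets n)
weight*product≤! zero    = ≤-refl ∷ []
weight*product≤! (suc n) = All-weightedSubsets-suc n skip take (weight*product≤! n)
  where
  skip : ∀ V w → w * product V ≤ n ! → n * w * product V ≤ suc n * n !
  skip V w ≤n! = subst (_≤ suc n * n !) (sym (*-assoc n w (product V))) (*-mono-≤ (n≤1+n n) ≤n!)
  take : ∀ V w → w * product V ≤ n ! → w * (suc n * product V) ≤ suc n * n !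
  take V w ≤n! = subst (_≤ suc n * n !) (sym (m*[n*o]≡n*[m*o] w (suc n) (product V))) (*-monoʳ-≤ (suc n) ≤n!)

contains1 : List ℕ → Bool
contains1 = any (_≡ᵇ 1)

weight≡0-unless-contains1 : ∀ n → All (λ p → contains1 (proj₁ p) ≡ false → proj₂ p ≡ 0) (weightedSubsets (suc n))
weight≡0-unless-contains1 zero    = (λ _ → refl) ∷ (λ ()) ∷ []
weight≡0-unless-contains1 (suc n) =
  All-weightedSubsets-suc (suc n) (λ _ _ w≡0 ∌1 → trans (cong (suc n *_) (w≡0 ∌1)) (*-zeroʳ (suc n))) (λ _ _ → id)
                          (weight≡0-unless-contains1 n)

-- ∏_{j ≤ n, j ∉ V} j / (j − 1) is at most the telescoping product ∏_{j = 2}^n j / (j − 1) = n when 1 ∈ V.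
!≤n*weight*product : ∀ n → All (λ p → contains1 (proj₁ p) ≡ true → suc n ! ≤ suc n * (proj₂ p * product (proj₁ p)))
                               (weightedSubsets (suc n))
!≤n*weight*product zero    = (λ ()) ∷ (λ _ → ≤-refl) ∷ []
!≤n*weight*product (suc n) = All-weightedSubsets-suc (suc n) skip take (!≤n*weight*product n)
  where
  N = suc n
  skip : ∀ V w → (contains1 V ≡ true → N ! ≤ N * (w * product V)) →
         contains1 V ≡ true → suc N ! ≤ suc N * (N * w * product V)
  skip V w ih ∋1 = *-monoʳ-≤ (suc N) (subst (N ! ≤_) (sym (*-assoc N w (product V))) (ih ∋1))
  take : ∀ V w → (contains1 V ≡ true → N ! ≤ N * (w * product V)) →
         contains1 V ≡ true → suc N ! ≤ suc N * (w * (suc N * product V))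
  take V w ih ∋1 = *-monoʳ-≤ (suc N) (begin
    N !                       ≤⟨ ih ∋1 ⟩
    N * (w * product V)       ≤⟨ *-monoˡ-≤ (w * product V) (n≤1+n N) ⟩
    suc N * (w * product V)   ≡⟨ m*[n*o]≡n*[m*o] w (suc N) (product V) ⟨
    w * (suc N * product V)   ∎)
    where open ≤-Reasoning

minList-≤ : ∀ {xs x} → x ∈ xs → minList xs ≤ x
minList-≤ {y ∷ ys} x∈ = foldr-preservesᵒ ⊓-≤ y ys (from-∈ x∈)
  where
  ⊓-≤ : ∀ {x} a b → a ≤ x ⊎ b ≤ x → a ⊓ b ≤ x
  ⊓-≤ a b (inj₁ a≤x) = ≤-trans (m⊓n≤m a b) a≤x
  ⊓-≤ a b (inj₂ b≤x) = ≤-trans (m⊓n≤n a b) b≤x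
  from-∈ : ∀ {x} → x ∈ y ∷ ys → y ≤ x ⊎ Any (_≤ x) ys
  from-∈ (here refl)  = inj₁ ≤-refl
  from-∈ (there x∈ys) = inj₂ (Any.map (λ { refl → ≤-refl }) x∈ys)

minList-∈ : ∀ {xs x} → x ∈ xs → minList xs ∈ xs
minList-∈ {y ∷ ys} _ with foldr-selective ⊓-sel y ys
... | inj₁ ≡y   = here ≡y
... | inj₂ ∈ys  = there ∈ys

IsAdmissible : ℕ → ℕ → List ℕ → Set
IsAdmissible n k V = V ∈ subsets n × contains1 V ≡ true × sum V ≡ k

∈-admissible⁺ : ∀ {n k V} → IsAdmissible n k V → V ∈ admissible n k
∈-admissible⁺ {n} {k} {V} (V∈ , ∋1 , ΣV≡k) =
  ∈-filter⁺ (λ U → T? (contains1 U ∧ (sum U ≡ᵇ k))) V∈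
            (Equivalence.from T-∧ (Equivalence.from T-≡ ∋1 , ≡⇒≡ᵇ (sum V) k ΣV≡k))

∈-admissible⁻ : ∀ {n k V} → V ∈ admissible n k → IsAdmissible n k V
∈-admissible⁻ {n} {k} {V} V∈ with ∈-filter⁻ (λ U → T? (contains1 U ∧ (sum U ≡ᵇ k))) {xs = subsets n} V∈
... | V∈subsets , holds with Equivalence.to T-∧ holds
...   | ∋1 , ΣV≡k = V∈subsets , Equivalence.to T-≡ ∋1 , ≡ᵇ⇒≡ (sum V) k ΣV≡k

∈-weightedSubsets⇒∈-subsets : ∀ {n p} → p ∈ weightedSubsets n → proj₁ p ∈ subsets n
∈-weightedSubsets⇒∈-subsets {n} p∈ = subst (_ ∈_) (map-proj₁-weightedSubsets n) (∈-map⁺ proj₁ p∈)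

m*𝒞≤2^n*n! : ∀ n k → m (suc n) k * 𝒞 (suc n) k ≤ 2 ^ suc n * suc n !
m*𝒞≤2^n*n! n k = begin
  m N k * 𝒞 N k                       ≡⟨ cong (m N k *_) (𝒞≡weightedCount N k) ⟩
  m N k * weightedCount N (_≡ᵇ k)     ≡⟨ *-distribˡ-sumMap (m N k) term ws ⟩
  ∑[ p ∈ ws ] (m N k * term p)        ≤⟨ sumMap-≤ (λ p → m N k * term p) ws term-bound ⟩
  length ws * N !                     ≡⟨ cong (_* N !) (length-weightedSubsets N) ⟩
  2 ^ N * N !                         ∎
  where
  open ≤-Reasoning
  N = suc n
  ws = weightedSubsets N
  term : List ℕ × ℕ → ℕ
  term p = if sum (proj₁ p) ≡ᵇ k then proj₂ p else 0
  term-bound : ∀ {p} → p ∈ ws → m N k * term p ≤ N !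
  term-bound {V , w} p∈ with sum V ≡ᵇ k in ΣV≡k | contains1 V in ∋1
  ... | false | _     = subst (_≤ N !) (sym (*-zeroʳ (m N k))) z≤n
  ... | true  | false = subst (λ w → m N k * w ≤ N !) (sym (All.lookup (weight≡0-unless-contains1 n) p∈ ∋1))
                              (subst (_≤ N !) (sym (*-zeroʳ (m N k))) z≤n)
  ... | true  | true  = begin
    m N k * w        ≤⟨ *-monoˡ-≤ w (minList-≤ (∈-map⁺ product V∈admissible)) ⟩
    product V * w    ≡⟨ *-comm (product V) w ⟩
    w * product V    ≤⟨ All.lookup (weight*product≤! N) p∈ ⟩
    N !              ∎
    where
    V∈admissible : V ∈ admissible N k
    V∈admissible =
      ∈-admissible⁺ {N} (∈-weightedSubsets⇒∈-subsets {N} p∈ , ∋1 , ≡ᵇ⇒≡ (sum V) k (Equivalence.from T-≡ ΣV≡k))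

n!≤n*∏V*𝒞 : ∀ n k {V} → V ∈ admissible (suc n) k → suc n ! ≤ suc n * product V * 𝒞 (suc n) k
n!≤n*∏V*𝒞 n k {V} V∈ with ∈-admissible⁻ {suc n} V∈
... | V∈subsets , ∋1 , ΣV≡k with ∈-map⁻ proj₁ (subst (V ∈_) (sym (map-proj₁-weightedSubsets (suc n))) V∈subsets)
...   | (.V , w) , p∈ , refl = begin
  N !                                    ≤⟨ All.lookup (!≤n*weight*product n) p∈ ∋1 ⟩
  N * (w * product V)                    ≡⟨ cong (N *_) (*-comm w (product V)) ⟩
  N * (product V * w)                    ≡⟨ *-assoc N (product V) w ⟨
  N * product V * w                      ≡⟨ cong (λ b → N * product V * (if b then w else 0)) (≡⇒≡ᵇ≡true ΣV≡k) ⟨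
  N * product V * term (V , w)           ≤⟨ *-monoʳ-≤ (N * product V) (∈⇒≤sumMap term p∈) ⟩
  N * product V * weightedCount N (_≡ᵇ k) ≡⟨ cong (N * product V *_) (𝒞≡weightedCount N k) ⟨
  N * product V * 𝒞 N k                  ∎
  where
  open ≤-Reasoning
  N = suc n
  term : List ℕ × ℕ → ℕ
  term p = if sum (proj₁ p) ≡ᵇ k then proj₂ p else 0

triangle : ℕ → ℕ
triangle zero    = 0
triangle (suc n) = suc n + triangle n

tri≡triangle : ∀ n → tri n ≡ triangle n
tri≡triangle n = trans (cong (_/ 2) (n*[1+n]≡triangle*2 n)) (m*n/n≡m (triangle n) 2)
  where
  n*[1+n]≡triangle*2 : ∀ n → n * suc n ≡ triangle n * 2
  n*[1+n]≡triangle*2 zero    = refl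
  n*[1+n]≡triangle*2 (suc n) = begin
    suc n * suc (suc n)             ≡⟨ [1+n]*[2+n]≡[1+n]*2+n*[1+n] n ⟩
    suc n * 2 + n * suc n           ≡⟨ cong (suc n * 2 +_) (n*[1+n]≡triangle*2 n) ⟩
    suc n * 2 + triangle n * 2      ≡⟨ *-distribʳ-+ 2 (suc n) (triangle n) ⟨
    triangle (suc n) * 2            ∎
    where
    open ≡-Reasoning
    [1+n]*[2+n]≡[1+n]*2+n*[1+n] : ∀ n → suc n * suc (suc n) ≡ suc n * 2 + n * suc n
    [1+n]*[2+n]≡[1+n]*2+n*[1+n] = solve-∀

Feasible : ℕ → ℕ → Set
Feasible n k = 1 ≤ k × k ≤ triangle n × k ≢ 2 × k + 1 ≢ triangle n

realizable-suc : ∀ n {k} → ∃ (IsAdmissible n k) → ∃ (IsAdmissible (suc n) k)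
realizable-suc n (V , V∈ , ∋1 , ΣV≡k) = V , ∈-++⁺ˡ V∈ , ∋1 , ΣV≡k

realizable-∷ : ∀ n {k k'} → suc n + k' ≡ k → ∃ (IsAdmissible n k') → ∃ (IsAdmissible (suc n) k)
realizable-∷ n refl (V , V∈ , ∋1 , ΣV≡k') =
  suc n ∷ V , ∈-++⁺ʳ (subsets n) (∈-map⁺ (suc n ∷_) V∈) , trans (cong (_ ∨_) ∋1) (∨-zeroʳ _) ,
  cong (suc n +_) ΣV≡k'

-- Apart from 2, T(n+1) − 1 is the only value in [1, T(n+1)] that is not feasible at level n+1;
-- at level n+2 it is reached as (n+2) + (T n − 2).
feasible-triangle∸2 : ∀ n → 3 ≤ triangle n → triangle n ≢ 4 → Feasible (suc n) (triangle n ∸ 2)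
feasible-triangle∸2 n 3≤Tn Tn≢4 = 1≤k , ≤-trans (m≤m+n k 1) (<⇒≤ k+1<TM) , k≢2 , <⇒≢ k+1<TM
  where
  k = triangle n ∸ 2
  2+k≡Tn : 2 + k ≡ triangle n
  2+k≡Tn = m+[n∸m]≡n (≤-trans (n≤1+n 2) 3≤Tn)
  1≤k : 1 ≤ k
  1≤k = s≤s⁻¹ (s≤s⁻¹ (subst (3 ≤_) (sym 2+k≡Tn) 3≤Tn))
  k+1<TM : k + 1 < triangle (suc n)
  k+1<TM = ≤-trans (≤-reflexive (+-comm (suc k) 1)) (subst (_≤ triangle (suc n)) (sym 2+k≡Tn) (m≤n+m (triangle n) (suc n)))
  k≢2 : k ≢ 2
  k≢2 k≡2 = Tn≢4 (trans (sym 2+k≡Tn) (cong (2 +_) k≡2))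

2+n+[triangle∸2]≡ : ∀ n {k} → 2 ≤ triangle n → k + 1 ≡ triangle (suc n) → suc (suc n) + (triangle n ∸ 2) ≡ k
2+n+[triangle∸2]≡ n {k} 2≤Tn k+1≡TM = suc-injective (begin
  suc (suc (suc n) + (triangle n ∸ 2))   ≡⟨ cong suc (trans (+-suc n _) (cong suc (+-suc n _))) ⟨
  suc n + (2 + (triangle n ∸ 2))         ≡⟨ cong (suc n +_) (m+[n∸m]≡n 2≤Tn) ⟩
  suc n + triangle n                     ≡⟨ k+1≡TM ⟨
  k + 1                                  ≡⟨ +-comm k 1 ⟩
  suc k                                  ∎)
  where open ≡-Reasoning

n+3≤triangle[1+n] : ∀ n → 3 ≤ triangle n → suc n + 3 ≤ triangle (suc n)
n+3≤triangle[1+n] n = +-monoʳ-≤ (suc n)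

2+n≤k : ∀ n {k} → 3 ≤ triangle n → triangle (suc n) < k → suc (suc n) ≤ k
2+n≤k n 3≤Tn TM<k =
  ≤-trans (m≤m+n (suc (suc n)) 2) (≤-trans (≤-reflexive (cong suc (sym (+-suc n 2))))
          (≤-trans (n+3≤triangle[1+n] n 3≤Tn) (<⇒≤ TM<k)))

feasible-∸ : ∀ n k → 3 ≤ triangle n → triangle (suc n) < k →
             Feasible (suc (suc n)) k → Feasible (suc n) (k ∸ suc (suc n))
feasible-∸ n k 3≤Tn TM<k (_ , k≤T , _ , k+1≢T) = ≤-trans (s≤s z≤n) 3≤k' , k'≤TM , <⇒≢ 3≤k' ∘ sym , k'+1≢TM
  where
  k' = k ∸ suc (suc n)
  k≡ : suc (suc n) + k' ≡ k
  k≡ = m+[n∸m]≡n (2+n≤k n 3≤Tn TM<k)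
  k'≤TM : k' ≤ triangle (suc n)
  k'≤TM = +-cancelˡ-≤ (suc (suc n)) k' (triangle (suc n)) (subst (_≤ triangle (suc (suc n))) (sym k≡) k≤T)
  3≤k' : 3 ≤ k'
  3≤k' = +-cancelˡ-≤ (suc n) 3 k'
           (s≤s⁻¹ (≤-trans (s≤s (n+3≤triangle[1+n] n 3≤Tn)) (subst (suc (triangle (suc n)) ≤_) (sym k≡) TM<k)))
  k'+1≢TM : k' + 1 ≢ triangle (suc n)
  k'+1≢TM e = k+1≢T (trans (cong (_+ 1) (sym k≡)) (trans (+-assoc (suc (suc n)) k' 1) (cong (suc (suc n) +_) e)))

feasible-step : ∀ n → 3 ≤ triangle n → triangle n ≢ 4 →
                (∀ k → Feasible (suc n) k → ∃ (IsAdmissible (suc n) k)) →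
                ∀ k → Feasible (suc (suc n)) k → ∃ (IsAdmissible (suc (suc n)) k)
feasible-step n 3≤Tn Tn≢4 ih k feasible@(1≤k , _ , k≢2 , _) with k + 1 ≟ triangle (suc n)
... | yes k+1≡TM = realizable-∷ (suc n) (2+n+[triangle∸2]≡ n (≤-trans (n≤1+n 2) 3≤Tn) k+1≡TM)
                                        (ih _ (feasible-triangle∸2 n 3≤Tn Tn≢4))
... | no  k+1≢TM with triangle (suc n) <? k
...   | no  k≤TM = realizable-suc (suc n) (ih k (1≤k , ≮⇒≥ k≤TM , k≢2 , k+1≢TM))
...   | yes TM<k = realizable-∷ (suc n) (m+[n∸m]≡n (2+n≤k n 3≤Tn TM<k)) (ih _ (feasible-∸ n k 3≤Tn TM<k feasible))

3≤triangle[2+n] : ∀ n → 3 ≤ triangle (suc (suc n))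
3≤triangle[2+n] n = s≤s (s≤s (≤-trans (s≤s z≤n) (m≤n+m (suc (n + triangle n)) n)))

triangle[2+n]≢4 : ∀ n → triangle (suc (suc n)) ≢ 4
triangle[2+n]≢4 zero    ()
triangle[2+n]≢4 (suc n) T≡4 =
  <⇒≢ (≤-trans (n≤1+n 5) (+-mono-≤ (s≤s (s≤s (s≤s z≤n))) (3≤triangle[2+n] n))) (sym T≡4)

realizable-1 : ∃ (IsAdmissible 1 1)
realizable-1 = 1 ∷ [] , there (here refl) , refl , refl

feasible⇒realizable : ∀ n k → Feasible (suc n) k → ∃ (IsAdmissible (suc n) k)
feasible⇒realizable 0 0 (() , _)
feasible⇒realizable 0 1 _ = realizable-1
feasible⇒realizable 0 (suc (suc k)) (_ , s≤s () , _)
feasible⇒realizable 1 0 (() , _)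
feasible⇒realizable 1 1 _ = realizable-suc 1 realizable-1
feasible⇒realizable 1 2 (_ , _ , k≢2 , _) = contradiction refl k≢2
feasible⇒realizable 1 3 _ = realizable-∷ 1 refl realizable-1
feasible⇒realizable 1 (suc (suc (suc (suc k)))) (_ , s≤s (s≤s (s≤s ())) , _)
feasible⇒realizable 2 0 (() , _)
feasible⇒realizable 2 1 _ = realizable-suc 2 (realizable-suc 1 realizable-1)
feasible⇒realizable 2 2 (_ , _ , k≢2 , _) = contradiction refl k≢2
feasible⇒realizable 2 3 _ = realizable-suc 2 (realizable-∷ 1 refl realizable-1)
feasible⇒realizable 2 4 _ = realizable-∷ 2 refl (realizable-suc 1 realizable-1)
feasible⇒realizable 2 5 (_ , _ , _ , k+1≢6) = contradiction refl k+1≢6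
feasible⇒realizable 2 6 _ = realizable-∷ 2 refl (realizable-∷ 1 refl realizable-1)
feasible⇒realizable 2 (suc (suc (suc (suc (suc (suc (suc k))))))) (_ , s≤s (s≤s (s≤s (s≤s (s≤s (s≤s ())))))  , _)
feasible⇒realizable (suc (suc (suc n))) =
  feasible-step (suc (suc n)) (3≤triangle[2+n] n) (triangle[2+n]≢4 n) (feasible⇒realizable (suc (suc n)))

n!≤n*m*𝒞 : ∀ n k → ∃ (IsAdmissible (suc n) k) → suc n ! ≤ suc n * m (suc n) k * 𝒞 (suc n) k
n!≤n*m*𝒞 n k (V , adm) =
  let V′ , V′∈ , m≡∏V′ = ∈-map⁻ product (minList-∈ (∈-map⁺ product (∈-admissible⁺ {suc n} adm)))
  in subst (λ x → suc n ! ≤ suc n * x * 𝒞 (suc n) k) (sym m≡∏V′) (n!≤n*∏V*𝒞 n k V′∈)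

proposition4p5 : (n k : ℕ) → 1 ≤ n → 1 ≤ k → k ≤ tri n → k ≢ 2 → k + 1 ≢ tri n →
                   (n ! ≤ n * m n k * 𝒞 n k) × (m n k * 𝒞 n k ≤ 2 ^ n * n !)
proposition4p5 (suc n) k _ 1≤k k≤tri k≢2 k+1≢tri = n!≤n*m*𝒞 n k (feasible⇒realizable n k feasible) , m*𝒞≤2^n*n! n k
  where
  feasible : Feasible (suc n) k
  feasible = 1≤k , subst (k ≤_) (tri≡triangle (suc n)) k≤tri , k≢2 , subst (k + 1 ≢_) (tri≡triangle (suc n)) k+1≢tri
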